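{- Let $n\ge s\ge 0$ be integers with $\frac13 n<s<\frac12 n$. Then $\mathrm{ex}(n,s)\ge g(n,s)$.
   Context: $\mathrm{ex}(n,s)$ is the maximum number of edges in a triangle-free graph on $n$ vertices with independence number at most $s$. For integers $n\ge s\ge 0$, define $g(n,s)=\frac12 ns$ if $s\le \frac13 n$; $g(n,s)=g_k(n,s)$ if $\frac{k}{3k-1}n\le s<\frac{k-1}{3k-4}n$ for some integer $k\ge 2$; and $g(n,s)=\lfloor n^2/4\rfloor$ if $\frac n2\le s\le n$; where $g_k(n,s)=\frac12 k(k-1)n^2-k(3k-4)ns+\frac12(3k-4)(3k-1)s^2$. -}

module Defs where

open import Data.Bool using (Bool; true; false; if_then_else_; _∧_)
open import Data.Nat using (ℕ; _<ᵇ_)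
open import Data.Fin using (Fin; toℕ)
open import Data.Fin.Subset using (Subset; _∈_; ∣_∣)
open import Data.List using (List; map; allFin)
open import Data.Nat.ListAction using (sum)
open import Data.Integer as ℤ using (ℤ; +_)
open import Relation.Binary.PropositionalEquality using (_≡_)

record Graph (n : ℕ) : Set where
  field
    adj   : Fin n → Fin n → Bool
    sym   : ∀ i j → adj i j ≡ adj j i
    irr   : ∀ i → adj i i ≡ false
open Graph public

edges : ∀ {n} → Graph n → ℕ
edges {n} G = sum (map (λ i → sum (map (λ j →
  if (adj G i j ∧ (toℕ i <ᵇ toℕ j)) then 1 else 0) (allFin n))) (allFin n))

TriangleFree : ∀ {n} → Graph n → Set
TriangleFree G = ∀ i j k → adj G i j ≡ true → adj G j k ≡ true → adj G i k ≡ true → Data.Empty.⊥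
  where import Data.Empty

Independent : ∀ {n} → Graph n → Subset n → Set
Independent G S = ∀ i j → i ∈ S → j ∈ S → adj G i j ≡ false

IndepAtMost : ∀ {n} → Graph n → ℕ → Set
IndepAtMost {n} G s = (S : Subset n) → Independent G S → ∣ S ∣ Data.Nat.≤ s
  where import Data.Nat

-- 2 * g_k(n,s) = k(k-1)n² - 2k(3k-4)ns + (3k-4)(3k-1)s², as an integer
twoG : ℕ → ℕ → ℕ → ℤ
twoG k n s = (K ℤ.* (K ℤ.- + 1) ℤ.* N ℤ.* N)
             ℤ.- (+ 2 ℤ.* K ℤ.* (+ 3 ℤ.* K ℤ.- + 4) ℤ.* N ℤ.* S)
             ℤ.+ ((+ 3 ℤ.* K ℤ.- + 4) ℤ.* (+ 3 ℤ.* K ℤ.- + 1) ℤ.* S ℤ.* S)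
  where K = + k ; N = + n ; S = + s

module Submission where

-- Put k = k' + 2.  The hypotheses let us write s = S = b + M and n = N = 2S + M with
-- b = a + c, M = k' b + a and a ≥ 1 (parametrise).  The graph is a blow-up of the
-- distance graph on ℕ in which x ~ y iff S ≤ |x - y| < 2S; that graph is triangle-free
-- because two consecutive links already span a distance of 2S.  The vertices form
-- three blocks of sizes S, S and M, and offset r in block β is sent to position
-- βS + r / b, so that adjacency between blocks is an order condition on the classes
-- r / b, cyclic along 0 → 1 → 2 → 0.  An independent set cannot meet all three blocks
-- (the three conditions are cyclically incompatible), and any two blocks carry a
-- matching, so α ≤ S.  All degrees are at least S except for a vertices missing c
-- each, so 2e ≥ N S - a c; a ring identity shows 2 g_k(N, S) = N S - a c.

open import Defs
open import Data.Nat using (ℕ; zero; suc; _+_; _*_; _∸_; _≤_; _<_; z≤n; s≤s; s≤s⁻¹; _<ᵇ_; _≤?_; _<?_; NonZero)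
open import Data.Nat.Properties
open import Data.Nat.DivMod using (_/_; m/n*n≤m; m/n≤m; m<n*o⇒m/o<n; m*n/n≡m; /-monoˡ-≤; m/n≡1+[m∸n]/n)
open import Data.Nat.ListAction using (sum)
open import Data.Integer.Tactic.RingSolver using (solve-∀)
open import Data.Nat.Tactic.RingSolver using (solve)
open import Algebra.Properties.CommutativeSemigroup +-commutativeSemigroup using (interchange; x∙yz≈y∙xz; xy∙z≈xz∙y)
open import Data.Bool using (Bool; true; false; if_then_else_; _∧_; _∨_)
import Data.Bool.Properties as Bool
open import Data.Fin using (Fin; toℕ)
import Data.Fin as Fin
open import Data.Fin.Subset using (Subset; _∈_; ∣_∣)
open import Data.List using ([]; _∷_; map; allFin; tabulate)
open import Data.List.Properties using (map-cong; map-tabulate)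
open import Data.Integer as ℤ using (ℤ; +_)
import Data.Integer.Properties as ℤP
open import Data.Product using (Σ; _×_; _,_; proj₁; proj₂)
open import Data.Sum using (_⊎_; inj₁; inj₂)
open import Data.Empty using (⊥; ⊥-elim)
open import Relation.Nullary using (¬_; Dec; yes; no; does)
open import Relation.Nullary.Decidable using (dec-true; dec-false; _×-dec_)
open import Relation.Binary.Definitions using (tri<; tri≈; tri>)
import Relation.Binary.PropositionalEquality as Eq
open Eq using (_≡_; refl; trans; cong; cong₂; subst; subst₂; module ≡-Reasoning)

∑ : ℕ → (ℕ → ℕ) → ℕ
∑ zero    f = 0
∑ (suc n) f = f 0 + ∑ n (λ i → f (suc i))

∑-cong : ∀ n {f g : ℕ → ℕ} → (∀ i → i < n → f i ≡ g i) → ∑ n f ≡ ∑ n g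
∑-cong zero    f≡g = refl
∑-cong (suc n) f≡g = cong₂ _+_ (f≡g 0 (s≤s z≤n)) (∑-cong n (λ i i<n → f≡g (suc i) (s≤s i<n)))

∑-mono : ∀ n {f g : ℕ → ℕ} → (∀ i → i < n → f i ≤ g i) → ∑ n f ≤ ∑ n g
∑-mono zero    f≤g = z≤n
∑-mono (suc n) f≤g = +-mono-≤ (f≤g 0 (s≤s z≤n)) (∑-mono n (λ i i<n → f≤g (suc i) (s≤s i<n)))

∑-+ : ∀ m n f → ∑ (m + n) f ≡ ∑ m f + ∑ n (λ i → f (m + i))
∑-+ zero    n f = refl
∑-+ (suc m) n f = trans (cong (_+_ (f 0)) (∑-+ m n (λ i → f (suc i)))) (Eq.sym (+-assoc (f 0) _ _))

∑-distrib : ∀ n f g → ∑ n (λ i → f i + g i) ≡ ∑ n f + ∑ n g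
∑-distrib zero    f g = refl
∑-distrib (suc n) f g = begin
  (f 0 + g 0) + ∑ n (λ i → f (suc i) + g (suc i))
    ≡⟨ cong (_+_ (f 0 + g 0)) (∑-distrib n (λ i → f (suc i)) (λ i → g (suc i))) ⟩
  (f 0 + g 0) + (∑ n (λ i → f (suc i)) + ∑ n (λ i → g (suc i)))
    ≡⟨ interchange (f 0) (g 0) _ _ ⟩
  (f 0 + ∑ n (λ i → f (suc i))) + (g 0 + ∑ n (λ i → g (suc i))) ∎
  where open ≡-Reasoning

∑-const : ∀ n c → ∑ n (λ _ → c) ≡ n * c
∑-const zero    c = refl
∑-const (suc n) c = cong (_+_ c) (∑-const n c)

∑-swap : ∀ m n (f : ℕ → ℕ → ℕ) → ∑ m (λ i → ∑ n (λ j → f i j)) ≡ ∑ n (λ j → ∑ m (λ i → f i j))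
∑-swap zero    n f = Eq.sym (trans (∑-const n 0) (*-zeroʳ n))
∑-swap (suc m) n f = trans (cong (_+_ (∑ n (f 0))) (∑-swap m n (λ i → f (suc i))))
                           (Eq.sym (∑-distrib n (f 0) (λ j → ∑ m (λ i → f (suc i) j))))

∑-extend : ∀ {m n} f → m ≤ n → ∑ m f ≤ ∑ n f
∑-extend {m} {n} f m≤n = begin
  ∑ m f                                   ≤⟨ m≤m+n (∑ m f) _ ⟩
  ∑ m f + ∑ (n ∸ m) (λ i → f (m + i))     ≡⟨ Eq.sym (∑-+ m (n ∸ m) f) ⟩
  ∑ (m + (n ∸ m)) f                       ≡⟨ cong (λ t → ∑ t f) (m+[n∸m]≡n m≤n) ⟩
  ∑ n f                                   ∎
  where open ≤-Reasoning

∑-interval : ∀ n g L R → R ≤ n → (∀ j → L ≤ j → j < R → g j ≡ 1) → R ∸ L ≤ ∑ n g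
∑-interval n g L R R≤n ones with L ≤? R
... | no  L≰R = ≤-trans (≤-reflexive (m≤n⇒m∸n≡0 (<⇒≤ (≰⇒> L≰R)))) z≤n
... | yes L≤R = begin
  R ∸ L                                   ≡⟨ Eq.sym (*-identityʳ (R ∸ L)) ⟩
  (R ∸ L) * 1                             ≡⟨ Eq.sym (∑-const (R ∸ L) 1) ⟩
  ∑ (R ∸ L) (λ _ → 1)                     ≡⟨ ∑-cong (R ∸ L) inside ⟩
  ∑ (R ∸ L) (λ j → g (L + j))             ≤⟨ m≤n+m _ (∑ L g) ⟩
  ∑ L g + ∑ (R ∸ L) (λ j → g (L + j))     ≡⟨ Eq.sym (∑-+ L (R ∸ L) g) ⟩
  ∑ (L + (R ∸ L)) g                       ≡⟨ cong (λ t → ∑ t g) (m+[n∸m]≡n L≤R) ⟩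
  ∑ R g                                   ≤⟨ ∑-extend g R≤n ⟩
  ∑ n g                                   ∎
  where
  open ≤-Reasoning
  inside : ∀ j → j < R ∸ L → 1 ≡ g (L + j)
  inside j j<R∸L = Eq.sym (ones (L + j) (m≤m+n L j)
    (subst (L + j <_) (m+[n∸m]≡n L≤R) (+-monoʳ-< L j<R∸L)))

∑-≤-length : ∀ n g → (∀ i → i < n → g i ≤ 1) → ∑ n g ≤ n
∑-≤-length n g g≤1 = ≤-trans (∑-mono n g≤1) (≤-reflexive (trans (∑-const n 1) (*-identityʳ n)))

∑-disjoint : ∀ n (g h : ℕ → ℕ) → (∀ i → g i ≤ 1) → (∀ i → h i ≤ 1)
             → (∀ i → i < n → g i ≡ 1 → h i ≡ 1 → ⊥) → ∑ n g + ∑ n h ≤ n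
∑-disjoint n g h g≤1 h≤1 disjoint =
  subst (_≤ n) (∑-distrib n g h) (∑-≤-length n (λ i → g i + h i) pointwise)
  where
  pointwise : ∀ i → i < n → g i + h i ≤ 1
  pointwise i i<n with g i in gi | h i in hi | g≤1 i | h≤1 i
  ... | 0 | _ | _ | hi≤1 = hi≤1
  ... | 1 | 0 | _ | _    = s≤s z≤n
  ... | 1 | 1 | _ | _    = ⊥-elim (disjoint i i<n gi hi)
  ... | suc (suc _) | _ | s≤s () | _
  ... | 1 | suc (suc _) | _ | s≤s ()

∑-≥ : ∀ n f s → (∀ i → i < n → s ≤ f i) → n * s ≤ ∑ n f
∑-≥ n f s s≤f = subst (_≤ ∑ n f) (∑-const n s) (∑-mono n s≤f)

∑-zero-or-positive : ∀ n g → ∑ n g ≡ 0 ⊎ Σ ℕ (λ i → i < n × 1 ≤ g i)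
∑-zero-or-positive zero    g = inj₁ refl
∑-zero-or-positive (suc n) g with g 0 in g0
... | suc _ = inj₂ (0 , s≤s z≤n , subst (1 ≤_) (Eq.sym g0) (s≤s z≤n))
... | zero with ∑-zero-or-positive n (λ i → g (suc i))
...   | inj₁ rest≡0           = inj₁ rest≡0
...   | inj₂ (i , i<n , 1≤gi) = inj₂ (suc i , s≤s i<n , 1≤gi)

sum-allFin : ∀ n (h : ℕ → ℕ) → sum (map (λ i → h (toℕ i)) (allFin n)) ≡ ∑ n h
sum-allFin n h = trans (cong sum (map-tabulate {n = n} (λ i → i) (λ i → h (toℕ i)))) (sum-tabulate n h)
  where
  sum-tabulate : ∀ n (h : ℕ → ℕ) → sum (tabulate {n = n} (λ i → h (toℕ i))) ≡ ∑ n h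
  sum-tabulate zero    h = refl
  sum-tabulate (suc n) h = cong (_+_ (h 0)) (sum-tabulate n (λ i → h (suc i)))

iverson : Bool → ℕ
iverson b = if b then 1 else 0

<⇒<ᵇ≡true : ∀ {x y} → x < y → (x <ᵇ y) ≡ true
<⇒<ᵇ≡true {zero}  {suc y} _         = refl
<⇒<ᵇ≡true {suc x} {suc y} (s≤s x<y) = <⇒<ᵇ≡true x<y

≥⇒<ᵇ≡false : ∀ {x y} → y ≤ x → (x <ᵇ y) ≡ false
≥⇒<ᵇ≡false {x}     {zero}  _         = refl
≥⇒<ᵇ≡false {suc x} {suc y} (s≤s y≤x) = ≥⇒<ᵇ≡false y≤x

module Induced (A : ℕ → ℕ → Bool) (A-sym : ∀ x y → A x y ≡ A y x) (A-irr : ∀ x → A x x ≡ false) where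

  graph : (n : ℕ) → Graph n
  graph n = record
    { adj = λ i j → A (toℕ i) (toℕ j)
    ; sym = λ i j → A-sym (toℕ i) (toℕ j)
    ; irr = λ i → A-irr (toℕ i)
    }

  degree : ℕ → ℕ → ℕ
  degree n x = ∑ n (λ y → iverson (A x y))

  -- Every edge {x, y} is counted once as (x, y) with x < y and once as (y, x).
  private
    forward : ℕ → ℕ → ℕ
    forward x y = iverson (A x y ∧ (x <ᵇ y))

    both-directions : ∀ x y → forward x y + forward y x ≡ iverson (A x y)
    both-directions x y with <-cmp x y
    ... | tri< x<y _ _ rewrite <⇒<ᵇ≡true x<y | ≥⇒<ᵇ≡false (<⇒≤ x<y)
                             | Bool.∧-identityʳ (A x y) | Bool.∧-zeroʳ (A y x) = +-identityʳ _
    ... | tri≈ _ refl _ rewrite A-irr x = refl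
    ... | tri> _ _ y<x rewrite <⇒<ᵇ≡true y<x | ≥⇒<ᵇ≡false (<⇒≤ y<x)
                             | Bool.∧-identityʳ (A y x) | Bool.∧-zeroʳ (A x y) | A-sym x y = refl

  handshake : ∀ n → 2 * edges (graph n) ≡ ∑ n (degree n)
  handshake n = begin
    2 * edges (graph n)                                       ≡⟨ cong (2 *_) edges≡ ⟩
    E + (E + 0)                                               ≡⟨ cong (_+_ E) (+-identityʳ E) ⟩
    E + E                                                     ≡⟨ cong (_+_ E) (∑-swap n n forward) ⟩
    E + ∑ n (λ x → ∑ n (λ y → forward y x))                   ≡⟨ Eq.sym (∑-distrib n _ _) ⟩
    ∑ n (λ x → ∑ n (forward x) + ∑ n (λ y → forward y x))     ≡⟨ ∑-cong n (λ x _ → Eq.sym (∑-distrib n _ _)) ⟩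
    ∑ n (λ x → ∑ n (λ y → forward x y + forward y x))         ≡⟨ ∑-cong n (λ x _ → ∑-cong n (λ y _ → both-directions x y)) ⟩
    ∑ n (degree n)                                            ∎
    where
    open ≡-Reasoning
    E = ∑ n (λ x → ∑ n (forward x))
    edges≡ : edges (graph n) ≡ E
    edges≡ = trans (cong sum (map-cong (λ i → sum-allFin n (forward (toℕ i))) (allFin n)))
                   (sum-allFin n (λ x → ∑ n (forward x)))

  open import Data.Vec.Base using ([]; _∷_; here; there)

  indicator : ∀ {n} → Subset n → ℕ → ℕ
  indicator []      _       = 0
  indicator (x ∷ p) zero    = iverson x
  indicator (x ∷ p) (suc i) = indicator p i

  indicator-card : ∀ {n} (p : Subset n) → ∣ p ∣ ≡ ∑ n (indicator p)
  indicator-card []          = refl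
  indicator-card (true ∷ p)  = cong suc (indicator-card p)
  indicator-card (false ∷ p) = indicator-card p

  indicator≤1 : ∀ {n} (p : Subset n) i → indicator p i ≤ 1
  indicator≤1 []          i       = z≤n
  indicator≤1 (true ∷ p)  zero    = ≤-refl
  indicator≤1 (false ∷ p) zero    = z≤n
  indicator≤1 (x ∷ p)     (suc i) = indicator≤1 p i

  indicator-member : ∀ {n} (p : Subset n) i → indicator p i ≡ 1 → Σ (Fin n) (λ f → toℕ f ≡ i × f ∈ p)
  indicator-member []          i       ()
  indicator-member (true ∷ p)  zero    _ = Fin.zero , refl , here
  indicator-member (false ∷ p) zero    ()
  indicator-member (x ∷ p)     (suc i) p[i]≡1 with indicator-member p i p[i]≡1
  ... | f , refl , f∈p = Fin.suc f , refl , there f∈p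

  independence-bound : ∀ n s
    → (∀ f → (∀ i → f i ≤ 1) → (∀ i j → f i ≡ 1 → f j ≡ 1 → A i j ≡ false) → ∑ n f ≤ s)
    → IndepAtMost (graph n) s
  independence-bound n s bound p p-independent =
    subst (_≤ s) (Eq.sym (indicator-card p)) (bound (indicator p) (indicator≤1 p) support-independent)
    where
    support-independent : ∀ i j → indicator p i ≡ 1 → indicator p j ≡ 1 → A i j ≡ false
    support-independent i j pi pj with indicator-member p i pi | indicator-member p j pj
    ... | fi , refl , fi∈p | fj , refl , fj∈p = p-independent fi fj fi∈p fj∈p

module DistanceGraph (S : ℕ) where

  Link : ℕ → ℕ → Set
  Link x y = x + S ≤ y × y < x + (S + S)

  link? : ∀ x y → Dec (Link x y)
  link? x y = (x + S ≤? y) ×-dec (y <? x + (S + S))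

  adjacent : ℕ → ℕ → Bool
  adjacent x y = does (link? x y) ∨ does (link? y x)

  adjacent-sym : ∀ x y → adjacent x y ≡ adjacent y x
  adjacent-sym x y = Bool.∨-comm (does (link? x y)) (does (link? y x))

  link⇒< : ∀ {x y} → Link x y → x < y
  link⇒< {x} {y} (x+S≤y , y<x+2S) = <-≤-trans (m<m+n x 0<S) x+S≤y
    where
    0<S : 0 < S
    0<S = +-cancelˡ-< (x + S) 0 S (begin-strict
      x + S + 0   ≡⟨ +-identityʳ (x + S) ⟩
      x + S       ≤⟨ x+S≤y ⟩
      y           <⟨ y<x+2S ⟩
      x + (S + S) ≡⟨ Eq.sym (+-assoc x S S) ⟩
      x + S + S   ∎)
      where open ≤-Reasoning

  adjacent-irr : ∀ x → adjacent x x ≡ false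
  adjacent-irr x rewrite dec-false (link? x x) (λ l → <-irrefl refl (link⇒< l)) = refl

  adjacent-intro : ∀ {x y} → Link x y → adjacent x y ≡ true
  adjacent-intro {x} {y} l rewrite dec-true (link? x y) l = refl

  adjacent-elim : ∀ x y → adjacent x y ≡ true → Link x y ⊎ Link y x
  adjacent-elim x y = either (link? x y) (link? y x)
    where
    either : ∀ {P Q : Set} (p? : Dec P) (q? : Dec Q) → does p? ∨ does q? ≡ true → P ⊎ Q
    either (yes p) _       _  = inj₁ p
    either (no _)  (yes q) _  = inj₂ q
    either (no _)  (no _)  ()

  -- Two consecutive links span a distance of at least 2S, so their ends are not linked.
  no-shortcut : ∀ {x y z} → Link x y → Link y z → ¬ Link x z × ¬ Link z x
  no-shortcut {x} {y} {z} lxy@(x+S≤y , _) lyz@(y+S≤z , _) =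
    (λ (_ , z<x+2S) → <-irrefl refl (<-≤-trans z<x+2S x+2S≤z)) ,
    (λ lzx → <-asym (<-trans (link⇒< lxy) (link⇒< lyz)) (link⇒< lzx))
    where
    x+2S≤z : x + (S + S) ≤ z
    x+2S≤z = begin
      x + (S + S) ≡⟨ Eq.sym (+-assoc x S S) ⟩
      x + S + S   ≤⟨ +-monoˡ-≤ S x+S≤y ⟩
      y + S       ≤⟨ y+S≤z ⟩
      z           ∎
      where open ≤-Reasoning

  -- The distance graph is triangle-free: orienting the three edges by Link, two of
  -- them always form a path whose ends are the third edge.
  no-triangle : ∀ x y z → adjacent x y ≡ true → adjacent y z ≡ true → adjacent x z ≡ true → ⊥
  no-triangle x y z xy yz xz with adjacent-elim x y xy | adjacent-elim y z yz | adjacent-elim x z xz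
  ... | inj₁ lxy | inj₁ lyz | inj₁ lxz = proj₁ (no-shortcut lxy lyz) lxz
  ... | inj₁ lxy | inj₁ lyz | inj₂ lzx = proj₂ (no-shortcut lxy lyz) lzx
  ... | inj₁ lxy | inj₂ lzy | inj₁ lxz = proj₁ (no-shortcut lxz lzy) lxy
  ... | inj₁ lxy | inj₂ lzy | inj₂ lzx = proj₁ (no-shortcut lzx lxy) lzy
  ... | inj₂ lyx | inj₁ lyz | inj₁ lxz = proj₁ (no-shortcut lyx lxz) lyz
  ... | inj₂ lyx | inj₁ lyz | inj₂ lzx = proj₁ (no-shortcut lyz lzx) lyx
  ... | inj₂ lyx | inj₂ lzy | inj₁ lxz = proj₂ (no-shortcut lzy lyx) lxz
  ... | inj₂ lyx | inj₂ lzy | inj₂ lzx = proj₁ (no-shortcut lzy lyx) lzx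

  link-shift : ∀ d {x y} → Link x y → Link (d + x) (d + y)
  link-shift d {x} {y} (x+S≤y , y<x+2S) =
    subst (_≤ d + y) (Eq.sym (+-assoc d x S)) (+-monoʳ-≤ d x+S≤y) ,
    subst (d + y <_) (Eq.sym (+-assoc d x (S + S))) (+-monoʳ-< d y<x+2S)

  link-next : ∀ {x y} → x ≤ y → y < S → Link x (S + y)
  link-next {x} {y} x≤y y<S =
    subst (_≤ S + y) (+-comm S x) (+-monoʳ-≤ S x≤y) ,
    (begin-strict
      S + y       <⟨ +-monoʳ-< S y<S ⟩
      S + S       ≤⟨ m≤n+m (S + S) x ⟩
      x + (S + S) ∎)
    where open ≤-Reasoning

  link-wrap : ∀ {x y} → y < x → x < S → Link x (S + (S + y))
  link-wrap {x} {y} y<x x<S =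
    (begin
      x + S       ≤⟨ +-monoˡ-≤ S (<⇒≤ x<S) ⟩
      S + S       ≤⟨ m≤m+n (S + S) y ⟩
      S + S + y   ≡⟨ +-assoc S S y ⟩
      S + (S + y) ∎) ,
    (begin-strict
      S + (S + y) ≡⟨ +-comm S (S + y) ⟩
      S + y + S   ≡⟨ +-assoc S y S ⟩
      S + (y + S) <⟨ +-monoʳ-< S (+-monoˡ-< S y<x) ⟩
      S + (x + S) ≡⟨ x∙yz≈y∙xz S x S ⟩
      x + (S + S) ∎)
    where open ≤-Reasoning

-- twoG k n s is, by definition, twice-g (+ k) (+ n) (+ s).
twice-g : ℤ → ℤ → ℤ → ℤ
twice-g K N S = (K ℤ.* (K ℤ.- + 1) ℤ.* N ℤ.* N)
                ℤ.- (+ 2 ℤ.* K ℤ.* (+ 3 ℤ.* K ℤ.- + 4) ℤ.* N ℤ.* S)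
                ℤ.+ ((+ 3 ℤ.* K ℤ.- + 4) ℤ.* (+ 3 ℤ.* K ℤ.- + 1) ℤ.* S ℤ.* S)

-- With k = k' + 2, b = a + c, M = k' b + a, S = b + M and N = 2S + M one has
-- 2 g_k(N, S) = N S - a c.  (The left-hand side is twice-g K N S written out, which
-- is what the ring solver needs to see.)
twice-g-construction : ∀ K′ A C →
  let B = A ℤ.+ C ; M = K′ ℤ.* B ℤ.+ A ; S = B ℤ.+ M ; N = S ℤ.+ (S ℤ.+ M) ; K = + 2 ℤ.+ K′
  in (K ℤ.* (K ℤ.- + 1) ℤ.* N ℤ.* N) ℤ.- (+ 2 ℤ.* K ℤ.* (+ 3 ℤ.* K ℤ.- + 4) ℤ.* N ℤ.* S)
     ℤ.+ ((+ 3 ℤ.* K ℤ.- + 4) ℤ.* (+ 3 ℤ.* K ℤ.- + 1) ℤ.* S ℤ.* S)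
     ≡ N ℤ.* S ℤ.- A ℤ.* C
twice-g-construction = solve-∀

x+y-y≡x : ∀ X Y → X ℤ.+ Y ℤ.- Y ≡ X
x+y-y≡x = solve-∀

-- Parameters: k = k' + 2, a = a' + 1 ≥ 1 and c ≥ 0.  With b = a + c the graph has
-- three blocks of vertices of sizes S, S and M, where
--   M = k' b + a,   S = b + M = (k' + 1) b + a,   N = 2S + M.
-- A vertex at offset r in block β ∈ {0, 1, 2} has class r / b and is placed at
-- position βS + r / b of the distance graph for S; vertices are adjacent iff their
-- positions are.  Between consecutive blocks this links class x to every class y ≥ x,
-- and from block 2 back to block 0 it links class z to every class x > z.
module Construction (k' a' c : ℕ) where

  a b M S N D : ℕ
  a = suc a'
  b = a + c
  M = k' * b + a
  S = b + M
  N = S + (S + M)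
  D = suc k' * b

  instance
    b≢0 : NonZero b
    b≢0 = _

  open DistanceGraph S

  class-≥ : ∀ {q t} → q * b ≤ t → q ≤ t / b
  class-≥ {q} {t} qb≤t = subst (_≤ t / b) (m*n/n≡m q b) (/-monoˡ-≤ b qb≤t)

  class-< : ∀ {q t} → t < q * b → t / b < q
  class-< = m<n*o⇒m/o<n

  class<S : ∀ {r} → r < S → r / b < S
  class<S {r} r<S = ≤-<-trans (m/n≤m r b) r<S

  class-next : ∀ r → (b + r) / b ≡ suc (r / b)
  class-next r = trans (m/n≡1+[m∸n]/n (m≤m+n b r)) (cong (λ t → suc (t / b)) (m+n∸m≡n b r))

  M≤S : M ≤ S
  M≤S = m≤n+m M b

  pos : ℕ → ℕ
  pos i = if does (i <? S) then i / b
          else (if does (i ∸ S <? S) then S + (i ∸ S) / b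
          else S + (S + (i ∸ S ∸ S) / b))

  pos₀ : ∀ {r} → r < S → pos r ≡ r / b
  pos₀ {r} r<S rewrite dec-true (r <? S) r<S = refl

  pos₁ : ∀ {r} → r < S → pos (S + r) ≡ S + r / b
  pos₁ {r} r<S rewrite dec-false (S + r <? S) (m+n≮m S r) | m+n∸m≡n S r | dec-true (r <? S) r<S = refl

  pos₂ : ∀ r → pos (S + (S + r)) ≡ S + (S + r / b)
  pos₂ r rewrite dec-false (S + (S + r) <? S) (m+n≮m S (S + r)) | m+n∸m≡n S (S + r)
               | dec-false (S + r <? S) (m+n≮m S r) | m+n∸m≡n S r = refl

  A : ℕ → ℕ → Bool
  A i j = adjacent (pos i) (pos j)

  A-sym : ∀ i j → A i j ≡ A j i
  A-sym i j = adjacent-sym (pos i) (pos j)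

  A-irr : ∀ i → A i i ≡ false
  A-irr i = adjacent-irr (pos i)

  open Induced A A-sym A-irr

  A-intro : ∀ i j {x y} → pos i ≡ x → pos j ≡ y → Link x y → A i j ≡ true
  A-intro i j pos-i pos-j l = subst₂ (λ x y → adjacent x y ≡ true) (Eq.sym pos-i) (Eq.sym pos-j) (adjacent-intro l)

  adj₀₁ : ∀ {r t} → r < S → t < S → r / b ≤ t / b → A r (S + t) ≡ true
  adj₀₁ {r} {t} r<S t<S x≤y = A-intro r (S + t) (pos₀ r<S) (pos₁ t<S) (link-next x≤y (class<S t<S))

  adj₁₂ : ∀ {t u} → t < S → u < S → t / b ≤ u / b → A (S + t) (S + (S + u)) ≡ true
  adj₁₂ {t} {u} t<S u<S y≤z = A-intro (S + t) (S + (S + u)) (pos₁ t<S) (pos₂ u) (link-shift S (link-next y≤z (class<S u<S)))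

  adj₂₀ : ∀ {r u} → r < S → u / b < r / b → A r (S + (S + u)) ≡ true
  adj₂₀ {r} {u} r<S z<x = A-intro r (S + (S + u)) (pos₀ r<S) (pos₂ u) (link-wrap z<x (class<S r<S))

  ∑-blocks : ∀ h → ∑ N h ≡ ∑ S h + (∑ S (λ t → h (S + t)) + ∑ M (λ u → h (S + (S + u))))
  ∑-blocks h = trans (∑-+ S (S + M) h) (cong (_+_ (∑ S h)) (∑-+ S M (λ t → h (S + t))))

  -- An independent set cannot meet all three
  -- blocks, and any two blocks are joined by a matching that leaves at most b
  -- vertices of the larger part uncovered, which bounds the set by S.
  module Independent (f : ℕ → ℕ) (f≤1 : ∀ i → f i ≤ 1)
                     (independent : ∀ i j → f i ≡ 1 → f j ≡ 1 → A i j ≡ false) where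

    F₀ F₁ F₂ : ℕ
    F₀ = ∑ S f
    F₁ = ∑ S (λ t → f (S + t))
    F₂ = ∑ M (λ u → f (S + (S + u)))

    not-both : ∀ {i j} → A i j ≡ true → f i ≡ 1 → f j ≡ 1 → ⊥
    not-both {i} {j} Aij fi fj with trans (Eq.sym Aij) (independent i j fi fj)
    ... | ()

    -- Blocks 0 and 1 are matched by r ↦ S + r.
    avoiding-block₂ : F₀ + F₁ ≤ S
    avoiding-block₂ = ∑-disjoint S f (λ t → f (S + t)) f≤1 (λ t → f≤1 (S + t))
      (λ r r<S → not-both (adj₀₁ r<S r<S ≤-refl))

    -- The first M vertices of block 1 are matched to block 2 by S + u ↦ 2S + u.
    avoiding-block₀ : F₁ + F₂ ≤ S
    avoiding-block₀ = begin
      F₁ + F₂                      ≡⟨ cong (_+ F₂) (trans (cong (λ m → ∑ m g) (+-comm b M)) (∑-+ M b g)) ⟩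
      (∑ M g + rest) + F₂          ≡⟨ xy∙z≈xz∙y (∑ M g) rest F₂ ⟩
      (∑ M g + F₂) + rest          ≤⟨ +-mono-≤ matched (∑-≤-length b _ (λ i _ → f≤1 (S + (M + i)))) ⟩
      M + b                        ≡⟨ +-comm M b ⟩
      S                            ∎
      where
      open ≤-Reasoning
      g : ℕ → ℕ
      g t = f (S + t)
      rest = ∑ b (λ i → g (M + i))
      matched : ∑ M g + F₂ ≤ M
      matched = ∑-disjoint M g (λ u → f (S + (S + u))) (λ t → f≤1 (S + t)) (λ u → f≤1 (S + (S + u)))
        (λ u u<M → not-both (adj₁₂ (<-≤-trans u<M M≤S) (<-≤-trans u<M M≤S) ≤-refl))

    -- The last M vertices of block 0 are matched to block 2 by b + u ↦ 2S + u.
    avoiding-block₁ : F₀ + F₂ ≤ S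
    avoiding-block₁ = begin
      F₀ + F₂                      ≡⟨ cong (_+ F₂) (∑-+ b M f) ⟩
      (∑ b f + shifted) + F₂       ≡⟨ +-assoc (∑ b f) shifted F₂ ⟩
      ∑ b f + (shifted + F₂)       ≤⟨ +-mono-≤ (∑-≤-length b f (λ i _ → f≤1 i)) matched ⟩
      b + M                        ∎
      where
      open ≤-Reasoning
      shifted = ∑ M (λ u → f (b + u))
      matched : shifted + F₂ ≤ M
      matched = ∑-disjoint M (λ u → f (b + u)) (λ u → f (S + (S + u))) (λ u → f≤1 (b + u)) (λ u → f≤1 (S + (S + u)))
        (λ u u<M → not-both (adj₂₀ (+-monoʳ-< b u<M) (subst (u / b <_) (Eq.sym (class-next u)) ≤-refl)))

    -- Vertices of classes x, y, z in blocks 0, 1, 2 that are pairwise non-adjacent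
    -- would satisfy y < x, z < y and x ≤ z.
    not-all-blocks : ∀ {r t u} → r < S → t < S → u < M → f r ≡ 1 → f (S + t) ≡ 1 → f (S + (S + u)) ≡ 1 → ⊥
    not-all-blocks {r} {t} {u} r<S t<S u<M fr ft fu = <-irrefl refl (<-≤-trans (<-trans z<y y<x) x≤z)
      where
      y<x : t / b < r / b
      y<x = ≰⇒> (λ x≤y → not-both (adj₀₁ r<S t<S x≤y) fr ft)
      z<y : u / b < t / b
      z<y = ≰⇒> (λ y≤z → not-both (adj₁₂ t<S (<-≤-trans u<M M≤S) y≤z) ft fu)
      x≤z : r / b ≤ u / b
      x≤z = ≮⇒≥ (λ z<x → not-both (adj₂₀ r<S z<x) fr fu)

    sum≤S : ∑ N f ≤ S
    sum≤S with ∑-zero-or-positive S f | ∑-zero-or-positive S (λ t → f (S + t))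
             | ∑-zero-or-positive M (λ u → f (S + (S + u)))
    ... | _ | _ | inj₁ F₂≡0 = subst (_≤ S) (begin
          F₀ + F₁               ≡⟨ cong (_+_ F₀) (Eq.sym (+-identityʳ F₁)) ⟩
          F₀ + (F₁ + 0)         ≡⟨ cong (λ x → F₀ + (F₁ + x)) (Eq.sym F₂≡0) ⟩
          F₀ + (F₁ + F₂)        ≡⟨ Eq.sym (∑-blocks f) ⟩
          ∑ N f                 ∎) avoiding-block₂
      where open ≡-Reasoning
    ... | inj₁ F₀≡0 | _ | _ = subst (_≤ S) (begin
          F₁ + F₂               ≡⟨ cong (_+ (F₁ + F₂)) (Eq.sym F₀≡0) ⟩
          F₀ + (F₁ + F₂)        ≡⟨ Eq.sym (∑-blocks f) ⟩
          ∑ N f                 ∎) avoiding-block₀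
      where open ≡-Reasoning
    ... | _ | inj₁ F₁≡0 | _ = subst (_≤ S) (begin
          F₀ + F₂               ≡⟨ cong (λ x → F₀ + (x + F₂)) (Eq.sym F₁≡0) ⟩
          F₀ + (F₁ + F₂)        ≡⟨ Eq.sym (∑-blocks f) ⟩
          ∑ N f                 ∎) avoiding-block₁
      where open ≡-Reasoning
    ... | inj₂ (r , r<S , 1≤fr) | inj₂ (t , t<S , 1≤ft) | inj₂ (u , u<M , 1≤fu) =
      ⊥-elim (not-all-blocks r<S t<S u<M (is-one 1≤fr) (is-one 1≤ft) (is-one 1≤fu))
      where
      is-one : ∀ {i} → 1 ≤ f i → f i ≡ 1
      is-one {i} 1≤fi = ≤-antisym (f≤1 i) 1≤fi

  S≡D+a : S ≡ D + a
  S≡D+a = Eq.sym (+-assoc b (k' * b) a)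

  D≡M+c : D ≡ M + c
  D≡M+c = trans (+-comm b (k' * b)) (Eq.sym (+-assoc (k' * b) a c))

  M≤D : M ≤ D
  M≤D = subst (M ≤_) (Eq.sym D≡M+c) (m≤m+n M c)

  -- Offsets r < D = (k' + 1) b lie in classes ≤ k', so (r / b) b ≤ k' b ≤ M.
  early-class : ∀ {r} → r < D → r / b * b ≤ M
  early-class {r} r<D = ≤-trans (*-monoˡ-≤ b (s≤s⁻¹ (class-< {suc k'} r<D))) (m≤m+n (k' * b) a)

  last-class : ∀ {r} → D ≤ r → r < S → r / b ≡ suc k'
  last-class {r} D≤r r<S = ≤-antisym (s≤s⁻¹ (class-< {suc (suc k')} r<S+)) (class-≥ {suc k'} D≤r)
    where
    r<S+ : r < suc (suc k') * b
    r<S+ = <-≤-trans r<S (subst (_≤ b + D) (Eq.sym S≡D+a)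
             (subst (_≤ b + D) (+-comm a D) (+-monoˡ-≤ D (m≤m+n a c))))

  into₀ into₁ into₂ : ℕ → ℕ
  into₀ v = ∑ S (λ j → iverson (A v j))
  into₁ v = ∑ S (λ t → iverson (A v (S + t)))
  into₂ v = ∑ M (λ u → iverson (A v (S + (S + u))))

  degree-blocks : ∀ v → degree N v ≡ into₀ v + (into₁ v + into₂ v)
  degree-blocks v = ∑-blocks (λ j → iverson (A v j))

  iverson-true : ∀ {x} → x ≡ true → iverson x ≡ 1
  iverson-true refl = refl

  iverson-A : ∀ i j → A j i ≡ true → iverson (A i j) ≡ 1
  iverson-A i j Aji = iverson-true (trans (A-sym i j) Aji)

  drop₀ : ∀ v → into₁ v + into₂ v ≤ degree N v
  drop₀ v = subst (into₁ v + into₂ v ≤_) (Eq.sym (degree-blocks v)) (m≤n+m _ (into₀ v))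

  drop₁ : ∀ v → into₀ v + into₂ v ≤ degree N v
  drop₁ v = subst (into₀ v + into₂ v ≤_) (Eq.sym (degree-blocks v)) (+-monoʳ-≤ (into₀ v) (m≤n+m _ (into₁ v)))

  drop₂ : ∀ v → into₀ v + into₁ v ≤ degree N v
  drop₂ v = subst (into₀ v + into₁ v ≤_) (Eq.sym (degree-blocks v)) (+-monoʳ-≤ (into₀ v) (m≤m+n _ (into₂ v)))

  defect : ℕ → ℕ
  defect r = if does (D ≤? r) then c else 0

  defect-last : ∀ {r} → D ≤ r → defect r ≡ c
  defect-last {r} D≤r rewrite dec-true (D ≤? r) D≤r = refl

  defect-early : ∀ {r} → r < D → defect r ≡ 0
  defect-early {r} r<D rewrite dec-false (D ≤? r) (<⇒≱ r<D) = refl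

  -- A vertex of block 0 in class x is adjacent to the classes ≥ x of block 1 and to
  -- the classes < x of block 2.  This misses nobody for x ≤ k', and c vertices of
  -- block 2 (which has no class k' + 1) for x = k' + 1.
  degree₀ : ∀ {r} → r < S → S ≤ degree N r + defect r
  degree₀ {r} r<S = ≤-trans by-blocks (+-monoˡ-≤ (defect r) (drop₀ r))
    where
    open ≤-Reasoning
    qb = r / b * b
    above : S ∸ qb ≤ into₁ r
    above = ∑-interval S _ qb S ≤-refl (λ t qb≤t t<S → iverson-true (adj₀₁ r<S t<S (class-≥ qb≤t)))
    below : ∀ L → L ≤ M → L ≤ qb → L ≤ into₂ r
    below L L≤M L≤qb = ∑-interval M _ 0 L L≤M
      (λ u _ u<L → iverson-true (adj₂₀ r<S (class-< (<-≤-trans u<L L≤qb))))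
    by-blocks : S ≤ into₁ r + into₂ r + defect r
    by-blocks with D ≤? r
    ... | no D≰r = begin
      S                            ≡⟨ Eq.sym (m∸n+n≡m (≤-trans (m/n*n≤m r b) (<⇒≤ r<S))) ⟩
      (S ∸ qb) + qb                ≤⟨ +-mono-≤ above (below qb (early-class (≰⇒> D≰r)) ≤-refl) ⟩
      into₁ r + into₂ r            ≤⟨ m≤m+n _ (defect r) ⟩
      into₁ r + into₂ r + defect r ∎
    ... | yes D≤r = begin
      S                            ≡⟨ Eq.sym (m∸n+n≡m (≤-trans D≤r (<⇒≤ r<S))) ⟩
      (S ∸ D) + D                  ≡⟨ cong (_+_ (S ∸ D)) D≡M+c ⟩
      (S ∸ D) + (M + c)            ≡⟨ Eq.sym (+-assoc (S ∸ D) M c) ⟩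
      (S ∸ D) + M + c              ≤⟨ +-mono-≤ (+-mono-≤ (subst (λ x → S ∸ x ≤ into₁ r) qb≡D above)
                                                        (below M ≤-refl (subst (M ≤_) (Eq.sym qb≡D) M≤D)))
                                               (≤-reflexive (Eq.sym (defect-last D≤r))) ⟩
      into₁ r + into₂ r + defect r ∎
      where
      qb≡D : qb ≡ D
      qb≡D = cong (_* b) (last-class D≤r r<S)

  -- A vertex of block 1 in class y is adjacent to the classes ≤ y of block 0 and to
  -- the classes ≥ y of block 2, i.e. to the first (y + 1) b vertices of block 0 and
  -- to all but the first y b vertices of block 2: at least S in total.
  degree₁ : ∀ {t} → t < S → S ≤ degree N (S + t)
  degree₁ {t} t<S with S ≤? suc (t / b) * b
  ... | yes S≤q'b = ≤-trans (∑-interval S _ 0 S ≤-refl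
          (λ j _ j<S → iverson-A (S + t) j (adj₀₁ j<S t<S (s≤s⁻¹ (class-< (<-≤-trans j<S S≤q'b))))))
        (≤-trans (m≤m+n _ (into₂ (S + t))) (drop₁ (S + t)))
  ... | no  S≰q'b = begin
    S                                ≡⟨ cong (_+_ b) (Eq.sym (m+[n∸m]≡n qb≤M)) ⟩
    b + (qb + (M ∸ qb))              ≡⟨ Eq.sym (+-assoc b qb (M ∸ qb)) ⟩
    (b + qb) + (M ∸ qb)              ≤⟨ +-mono-≤ (∑-interval S _ 0 (b + qb) (<⇒≤ q'b<S)
                                           (λ j _ j<q'b → iverson-A (S + t) j (adj₀₁ (<-trans j<q'b q'b<S) t<S
                                              (s≤s⁻¹ (class-< {suc (t / b)} j<q'b)))))
                                         (∑-interval M _ qb M ≤-refl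
                                           (λ u qb≤u u<M → iverson-true (adj₁₂ t<S (<-≤-trans u<M M≤S) (class-≥ qb≤u)))) ⟩
    into₀ (S + t) + into₂ (S + t)    ≤⟨ drop₁ (S + t) ⟩
    degree N (S + t)                 ∎
    where
    open ≤-Reasoning
    qb = t / b * b
    q'b<S : b + qb < S
    q'b<S = ≰⇒> S≰q'b
    qb≤M : qb ≤ M
    qb≤M = <⇒≤ (+-cancelˡ-< b qb M q'b<S)

  -- A vertex of block 2 in class z is adjacent to the classes > z of block 0 and to
  -- the classes ≤ z of block 1: all but the first (z + 1) b vertices of block 0 and
  -- the first (z + 1) b vertices of block 1.
  degree₂ : ∀ {u} → u < M → S ≤ degree N (S + (S + u))
  degree₂ {u} u<M = begin
    S                                ≡⟨ Eq.sym (m∸n+n≡m q'b≤S) ⟩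
    (S ∸ q'b) + q'b                  ≤⟨ +-mono-≤ (∑-interval S _ q'b S ≤-refl
                                           (λ j q'b≤j j<S → iverson-A v j (adj₂₀ j<S (class-≥ {suc (u / b)} q'b≤j))))
                                         (∑-interval S _ 0 q'b q'b≤S
                                           (λ t _ t<q'b → iverson-A v (S + t) (adj₁₂ (<-≤-trans t<q'b q'b≤S) u<S
                                              (s≤s⁻¹ (class-< {suc (u / b)} t<q'b))))) ⟩
    into₀ v + into₁ v                ≤⟨ drop₂ v ⟩
    degree N v                       ∎
    where
    open ≤-Reasoning
    v = S + (S + u)
    u<S : u < S
    u<S = <-≤-trans u<M M≤S
    q'b = suc (u / b) * b
    q'b≤S : q'b ≤ S
    q'b≤S = +-monoʳ-≤ b (≤-trans (m/n*n≤m u b) (<⇒≤ u<M))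

  -- Only the a vertices of the last class of block 0 have a defect, of size c.
  ∑-defect : ∑ S defect ≡ a * c
  ∑-defect = begin
    ∑ S defect                                 ≡⟨ cong (λ m → ∑ m defect) S≡D+a ⟩
    ∑ (D + a) defect                           ≡⟨ ∑-+ D a defect ⟩
    ∑ D defect + ∑ a (λ i → defect (D + i))    ≡⟨ cong₂ _+_ (∑-cong D (λ r r<D → defect-early r<D))
                                                            (∑-cong a (λ i _ → defect-last (m≤m+n D i))) ⟩
    ∑ D (λ _ → 0) + ∑ a (λ _ → c)              ≡⟨ cong₂ _+_ (trans (∑-const D 0) (*-zeroʳ D)) (∑-const a c) ⟩
    a * c                                      ∎
    where open ≡-Reasoning

  degree-sum : N * S ≤ ∑ N (degree N) + a * c
  degree-sum = begin
    (S + (S + M)) * S                          ≡⟨ *-distribʳ-+ S S (S + M) ⟩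
    S * S + (S + M) * S                        ≡⟨ cong (_+_ (S * S)) (*-distribʳ-+ S S M) ⟩
    S * S + (S * S + M * S)                    ≤⟨ +-mono-≤ block₀ (+-mono-≤ (∑-≥ S _ S (λ t → degree₁))
                                                                           (∑-≥ M _ S (λ u → degree₂))) ⟩
    (deg₀ + a * c) + (deg₁ + deg₂)             ≡⟨ xy∙z≈xz∙y deg₀ (a * c) (deg₁ + deg₂) ⟩
    (deg₀ + (deg₁ + deg₂)) + a * c             ≡⟨ cong (_+ a * c) (Eq.sym (∑-blocks (degree N))) ⟩
    ∑ N (degree N) + a * c                     ∎
    where
    open ≤-Reasoning
    deg₀ = ∑ S (degree N)
    deg₁ = ∑ S (λ t → degree N (S + t))
    deg₂ = ∑ M (λ u → degree N (S + (S + u)))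
    block₀ : S * S ≤ deg₀ + a * c
    block₀ = begin
      S * S                                    ≤⟨ ∑-≥ S _ S (λ r → degree₀) ⟩
      ∑ S (λ r → degree N r + defect r)        ≡⟨ ∑-distrib S (degree N) defect ⟩
      deg₀ + ∑ S defect                        ≡⟨ cong (_+_ deg₀) ∑-defect ⟩
      deg₀ + a * c                             ∎

  G : Graph N
  G = graph N

  G-triangle-free : TriangleFree G
  G-triangle-free i j k = no-triangle (pos (toℕ i)) (pos (toℕ j)) (pos (toℕ k))

  G-independence : IndepAtMost G S
  G-independence = independence-bound N S Independent.sum≤S

  G-edges : twoG (suc (suc k')) N S ℤ.≤ + (2 * edges G)
  G-edges = begin
    twice-g K (+ N) (+ S)                     ≡⟨ cong₂ (twice-g K) N≡ S≡ ⟩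
    twice-g K Nℤ Sℤ                           ≡⟨ twice-g-construction (+ k') (+ a) (+ c) ⟩
    Nℤ ℤ.* Sℤ ℤ.- + a ℤ.* + c                 ≡⟨ cong₂ (λ x y → x ℤ.* y ℤ.- + a ℤ.* + c) (Eq.sym N≡) (Eq.sym S≡) ⟩
    + N ℤ.* + S ℤ.- + a ℤ.* + c               ≡⟨ cong₂ ℤ._-_ (Eq.sym (ℤP.pos-* N S)) (Eq.sym (ℤP.pos-* a c)) ⟩
    + (N * S) ℤ.- + (a * c)                   ≤⟨ ℤP.+-monoˡ-≤ (ℤ.- + (a * c)) (ℤ.+≤+ degree-sum) ⟩
    + (∑ N (degree N) + a * c) ℤ.- + (a * c)  ≡⟨ x+y-y≡x (+ ∑ N (degree N)) (+ (a * c)) ⟩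
    + ∑ N (degree N)                          ≡⟨ cong +_ (Eq.sym (handshake N)) ⟩
    + (2 * edges G)                           ∎
    where
    open ℤP.≤-Reasoning
    K = + suc (suc k')
    Mℤ = + k' ℤ.* (+ a ℤ.+ + c) ℤ.+ + a
    Sℤ = (+ a ℤ.+ + c) ℤ.+ Mℤ
    Nℤ = Sℤ ℤ.+ (Sℤ ℤ.+ Mℤ)
    M≡ : + M ≡ Mℤ
    M≡ = cong (ℤ._+ + a) (ℤP.pos-* k' b)
    S≡ : + S ≡ Sℤ
    S≡ = cong (ℤ._+_ (+ b)) M≡
    N≡ : + N ≡ Nℤ
    N≡ = cong₂ ℤ._+_ S≡ (cong₂ ℤ._+_ S≡ M≡)

-- With k = k' + 2, the hypotheses give natural numbers
--   b = 3s - n ≥ 1,   a = (k - 1) n - (3k - 4) s ≥ 1,   c = (3k - 1) s - k n,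
-- and then a + c = b, s = (k - 1) b + a = S and n = 3s - b = N.
parametrise : ∀ {n s k'} → n < 3 * s → suc (suc k') * n ≤ (3 * suc (suc k') ∸ 1) * s
  → (3 * suc (suc k') ∸ 4) * s < suc k' * n
  → Σ ℕ λ a' → Σ ℕ λ c → n ≡ Construction.N k' a' c × s ≡ Construction.S k' a' c
parametrise {n} {s} {k'} n<3s kn≤[3k-1]s [3k-4]s<[k-1]n
  with m≤n⇒∃[o]m+o≡n n<3s | m≤n⇒∃[o]m+o≡n [3k-4]s<[k-1]n | m≤n⇒∃[o]m+o≡n kn≤[3k-1]s
... | e , n+1+e≡3s | a' , [3k-4]s+1+a'≡[k-1]n | c , kn+c≡[3k-1]s = a' , c , n≡N , s≡S
  where
  open ≡-Reasoning
  B a : ℕ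
  B = suc e
  a = suc a'

  3k-4≡ : 3 * suc (suc k') ∸ 4 ≡ 2 + 3 * k'
  3k-4≡ = trans (cong (_∸ 4) 3k≡) (m+n∸n≡m (2 + 3 * k') 4)
    where
    3k≡ : 3 * suc (suc k') ≡ (2 + 3 * k') + 4
    3k≡ = solve (k' ∷ [])

  3k-1≡ : 3 * suc (suc k') ∸ 1 ≡ 5 + 3 * k'
  3k-1≡ = trans (cong (_∸ 1) 3k≡) (m+n∸n≡m (5 + 3 * k') 1)
    where
    3k≡ : 3 * suc (suc k') ≡ (5 + 3 * k') + 1
    3k≡ = solve (k' ∷ [])

  3s≡ : 3 * s ≡ n + B
  3s≡ = trans (Eq.sym n+1+e≡3s) (Eq.sym (+-suc n e))

  [k-1]n≡ : suc k' * n ≡ (2 + 3 * k') * s + a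
  [k-1]n≡ = begin
    suc k' * n                         ≡⟨ Eq.sym [3k-4]s+1+a'≡[k-1]n ⟩
    suc ((3 * suc (suc k') ∸ 4) * s) + a'  ≡⟨ cong (λ x → suc (x * s) + a') 3k-4≡ ⟩
    suc ((2 + 3 * k') * s) + a'        ≡⟨ Eq.sym (+-suc _ a') ⟩
    (2 + 3 * k') * s + a               ∎

  [3k-1]s≡ : (5 + 3 * k') * s ≡ suc (suc k') * n + c
  [3k-1]s≡ = trans (cong (_* s) (Eq.sym 3k-1≡)) (Eq.sym kn+c≡[3k-1]s)

  -- s = a + (k - 1) b, from (k - 1) · 3s computed in two ways.
  s≡a+[k-1]B : s ≡ a + suc k' * B
  s≡a+[k-1]B = +-cancelˡ-≡ ((2 + 3 * k') * s) s (a + suc k' * B) (begin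
    (2 + 3 * k') * s + s               ≡⟨ solve (k' ∷ s ∷ []) ⟩
    suc k' * (3 * s)                   ≡⟨ cong (suc k' *_) 3s≡ ⟩
    suc k' * (n + B)                   ≡⟨ *-distribˡ-+ (suc k') n B ⟩
    suc k' * n + suc k' * B            ≡⟨ cong (_+ suc k' * B) [k-1]n≡ ⟩
    (2 + 3 * k') * s + a + suc k' * B  ≡⟨ +-assoc _ a (suc k' * B) ⟩
    (2 + 3 * k') * s + (a + suc k' * B) ∎)

  -- k b = c + s, from k · 3s computed in two ways.
  kB≡c+s : suc (suc k') * B ≡ c + s
  kB≡c+s = +-cancelˡ-≡ (suc (suc k') * n) _ _ (begin
    suc (suc k') * n + suc (suc k') * B  ≡⟨ Eq.sym (*-distribˡ-+ (suc (suc k')) n B) ⟩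
    suc (suc k') * (n + B)               ≡⟨ cong (suc (suc k') *_) (Eq.sym 3s≡) ⟩
    suc (suc k') * (3 * s)               ≡⟨ solve (k' ∷ s ∷ []) ⟩
    (5 + 3 * k') * s + s                 ≡⟨ cong (_+ s) [3k-1]s≡ ⟩
    suc (suc k') * n + c + s             ≡⟨ +-assoc _ c s ⟩
    suc (suc k') * n + (c + s)           ∎)

  B≡a+c : B ≡ a + c
  B≡a+c = +-cancelʳ-≡ (suc k' * B) B (a + c) (begin
    B + suc k' * B                       ≡⟨ kB≡c+s ⟩
    c + s                                ≡⟨ cong (_+_ c) s≡a+[k-1]B ⟩
    c + (a + suc k' * B)                 ≡⟨ Eq.sym (+-assoc c a _) ⟩
    c + a + suc k' * B                   ≡⟨ cong (_+ suc k' * B) (+-comm c a) ⟩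
    a + c + suc k' * B                   ∎)

  regroup : ∀ x y → x + suc k' * (x + y) ≡ (x + y) + (k' * (x + y) + x)
  regroup x y = solve (k' ∷ x ∷ y ∷ [])

  triple : ∀ x y → let S = (x + y) + (k' * (x + y) + x) in 3 * S ≡ S + (S + (k' * (x + y) + x)) + (x + y)
  triple x y = solve (k' ∷ x ∷ y ∷ [])

  s≡S : s ≡ Construction.S k' a' c
  s≡S = begin
    s                                    ≡⟨ s≡a+[k-1]B ⟩
    a + suc k' * B                       ≡⟨ cong (λ x → a + suc k' * x) B≡a+c ⟩
    a + suc k' * (a + c)                 ≡⟨ regroup a c ⟩
    (a + c) + (k' * (a + c) + a)         ∎

  n≡N : n ≡ Construction.N k' a' c
  n≡N = +-cancelʳ-≡ B n N (begin
    n + B                                ≡⟨ Eq.sym 3s≡ ⟩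
    3 * s                                ≡⟨ cong (3 *_) s≡S ⟩
    3 * Construction.S k' a' c           ≡⟨ triple a c ⟩
    N + (a + c)                          ≡⟨ cong (_+_ N) (Eq.sym B≡a+c) ⟩
    N + B                                ∎)
    where N = Construction.N k' a' c

fact1p5 : (n s k : ℕ) → s ≤ n → n < 3 * s → 2 * s < n
    → 2 ≤ k → k * n ≤ (3 * k ∸ 1) * s → (3 * k ∸ 4) * s < (k ∸ 1) * n
    → Σ (Graph n) (λ G → TriangleFree G × IndepAtMost G s
    × twoG k n s ℤ.≤ + (2 * edges G))
fact1p5 n s (suc (suc k')) _ n<3s _ _ kn≤[3k-1]s [3k-4]s<[k-1]n
  with parametrise {k' = k'} n<3s kn≤[3k-1]s [3k-4]s<[k-1]n
... | a' , c , refl , refl = G , G-triangle-free , G-independence , G-edges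
  where open Construction k' a' c
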